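{- Let $d,t,s,n$ be positive integers such that $t\geq 4s^2$ and $d\geq 4n\cdot 2^s$. Then every $d\times t$ matrix whose entries are each colored red or blue contains an $n\times s$ monochromatic submatrix, i.e. there exist $n$ rows and $s$ columns such that all $ns$ entries in their intersection have the same color. -}

module Defs where

open import Data.Nat using (ℕ)
open import Data.Fin using (Fin)
open import Data.Bool using (Bool)
open import Data.Product using (Σ; ∃; _×_)
open import Function.Definitions using (Injective)
open import Relation.Binary.PropositionalEquality using (_≡_)

Coloring : ℕ → ℕ → Set
Coloring d t = Fin d → Fin t → Bool

HasMonoSubmatrix : {d t : ℕ} → Coloring d t → ℕ → ℕ → Set
HasMonoSubmatrix {d} {t} M n s =
  Σ (Fin n → Fin d) λ rows → Σ (Fin s → Fin t) λ cols →
    Injective _≡_ _≡_ rows × Injective _≡_ _≡_ cols ×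
    ∃ λ (c : Bool) → ∀ i j → M (rows i) (cols j) ≡ c

-- Pick a colour c and at least d/2 rows each having at least t/2 entries of colour c (a majority
-- argument, once per row and once over the rows).  Then choose the s columns greedily: if every
-- candidate row has at least q + s entries of colour c, double counting gives a column j that is
-- coloured c in at least |R|(q + s)/t candidate rows R; keep those rows, delete column j and recurse.
-- The invariant  n t^s ≤ |R| (q + 1)(q + 2)⋯(q + s)  survives each step, and it holds initially
-- because (2(q + s))^s ≤ 2^(s+1) (q + 1)⋯(q + s) when 2s² ≤ q + s, a reverse Bernoulli inequality.

module Submission where

open import Defs
open import Data.Nat using (ℕ; zero; suc; _+_; _*_; _^_; _∸_; _≤_; z≤n; s≤s; s≤s⁻¹; NonZero; ⌊_/2⌋; ⌈_/2⌉)
open import Data.Nat.Properties hiding (suc-injective; _≟_)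
open import Data.Nat.Tactic.RingSolver using (solve-∀)
open import Algebra.Properties.Semiring.Sum +-*-semiring
  using (sum; sum-syntax; sum-cong-≗; sum-remove; ∑-distrib-+; ∑-comm; *-distribˡ-sum; *-distribʳ-sum)
open import Data.Bool using (Bool; true; false; if_then_else_)
open import Data.Bool.Properties using (_≟_)
open import Data.Fin using (Fin; zero; suc; punchIn; lift)
open import Data.Fin.Properties using (suc-injective; punchIn-injective; punchInᵢ≢i; lift-injective)
open import Data.Vec.Functional using (_∷_; removeAt)
open import Data.Product using (Σ; ∃; _×_; _,_; proj₁; proj₂)
open import Data.Sum using (_⊎_; inj₁; inj₂)
open import Function using (_∘_)
open import Function.Definitions using (Injective)
open import Level using (Level; 0ℓ)
open import Relation.Nullary using (Dec; yes; no; does; contradiction)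
open import Relation.Nullary.Decidable using (_×-dec_)
open import Relation.Unary using (Pred; Decidable)
open import Relation.Binary.PropositionalEquality

private
  variable
    a b p : Level
    A : Set a
    B : Set b
    m n d t : ℕ

2*m≡m+m : ∀ m → 2 * m ≡ m + m
2*m≡m+m m = cong (m +_) (+-identityʳ m)

⌈2*m/2⌉≡m : ∀ m → ⌈ 2 * m /2⌉ ≡ m
⌈2*m/2⌉≡m m = sym (trans (n≡⌈n+n/2⌉ m) (cong ⌈_/2⌉ (sym (2*m≡m+m m))))

n≤2*⌈n/2⌉ : ∀ n → n ≤ 2 * ⌈ n /2⌉
n≤2*⌈n/2⌉ n = begin
  n                     ≡⟨ ⌊n/2⌋+⌈n/2⌉≡n n ⟨
  ⌊ n /2⌋ + ⌈ n /2⌉     ≤⟨ +-monoˡ-≤ ⌈ n /2⌉ (⌊n/2⌋≤⌈n/2⌉ n) ⟩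
  ⌈ n /2⌉ + ⌈ n /2⌉     ≡⟨ 2*m≡m+m ⌈ n /2⌉ ⟨
  2 * ⌈ n /2⌉           ∎
  where open ≤-Reasoning

n≤2*m⇒⌈n/2⌉≤m : n ≤ 2 * m → ⌈ n /2⌉ ≤ m
n≤2*m⇒⌈n/2⌉≤m {m = m} n≤2m = subst (_ ≤_) (⌈2*m/2⌉≡m m) (⌈n/2⌉-mono n≤2m)

2*m≤n⇒m≤⌈n/2⌉ : 2 * m ≤ n → m ≤ ⌈ n /2⌉
2*m≤n⇒m≤⌈n/2⌉ {m = m} 2m≤n = subst (_≤ _) (⌈2*m/2⌉≡m m) (⌈n/2⌉-mono 2m≤n)

^-distribʳ-* : ∀ m n k → (m * n) ^ k ≡ m ^ k * n ^ k
^-distribʳ-* m n zero    = refl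
^-distribʳ-* m n (suc k) = begin
  m * n * (m * n) ^ k       ≡⟨ cong (m * n *_) (^-distribʳ-* m n k) ⟩
  m * n * (m ^ k * n ^ k)   ≡⟨ reorder m n (m ^ k) (n ^ k) ⟩
  m * m ^ k * (n * n ^ k)   ∎
  where
  open ≡-Reasoning
  reorder : ∀ w x y z → w * x * (y * z) ≡ w * y * (x * z)
  reorder = solve-∀

[b+c]^k*d≤b^[1+k] : ∀ k b c d → d + k * c ≤ b → (b + c) ^ k * d ≤ b ^ suc k
[b+c]^k*d≤b^[1+k] zero b c d d≤b = begin
  1 * d   ≡⟨ *-identityˡ d ⟩
  d       ≤⟨ ≤-trans (m≤m+n d 0) d≤b ⟩
  b       ≡⟨ *-identityʳ b ⟨
  b * 1   ∎
  where open ≤-Reasoning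
[b+c]^k*d≤b^[1+k] (suc k) b c d d+[1+k]c≤b = begin
  (b + c) * (b + c) ^ k * d     ≡⟨ reorder (b + c) ((b + c) ^ k) d ⟩
  (b + c) ^ k * ((b + c) * d)   ≤⟨ *-monoʳ-≤ ((b + c) ^ k) [b+c]d≤b[d+c] ⟩
  (b + c) ^ k * (b * (d + c))   ≡⟨ reorder′ ((b + c) ^ k) b (d + c) ⟩
  b * ((b + c) ^ k * (d + c))   ≤⟨ *-monoʳ-≤ b ([b+c]^k*d≤b^[1+k] k b c (d + c) d+c+kc≤b) ⟩
  b * b ^ suc k                 ∎
  where
  open ≤-Reasoning
  reorder : ∀ x y z → x * y * z ≡ y * (x * z)
  reorder = solve-∀
  reorder′ : ∀ x y z → x * (y * z) ≡ y * (x * z)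
  reorder′ = solve-∀
  d+c+kc≤b : d + c + k * c ≤ b
  d+c+kc≤b = subst (_≤ b) (sym (+-assoc d c (k * c))) d+[1+k]c≤b
  [b+c]d≤b[d+c] : (b + c) * d ≤ b * (d + c)
  [b+c]d≤b[d+c] = begin
    (b + c) * d       ≡⟨ *-distribʳ-+ d b c ⟩
    b * d + c * d     ≤⟨ +-monoʳ-≤ (b * d) (*-monoʳ-≤ c (≤-trans (m≤m+n d _) d+[1+k]c≤b)) ⟩
    b * d + c * b     ≡⟨ cong (b * d +_) (*-comm c b) ⟩
    b * d + b * c     ≡⟨ *-distribˡ-+ b d c ⟨
    b * (d + c)       ∎

[2d+c]^k≤2*[2d]^k : ∀ k d c .{{_ : NonZero d}} → k * c ≤ d → (2 * d + c) ^ k ≤ 2 * (2 * d) ^ k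
[2d+c]^k≤2*[2d]^k k d c kc≤d = *-cancelʳ-≤ _ _ d (begin
  (2 * d + c) ^ k * d   ≤⟨ [b+c]^k*d≤b^[1+k] k (2 * d) c d d+kc≤2d ⟩
  2 * d * (2 * d) ^ k   ≡⟨ reorder d ((2 * d) ^ k) ⟩
  2 * (2 * d) ^ k * d   ∎)
  where
  open ≤-Reasoning
  reorder : ∀ x y → 2 * x * y ≡ 2 * y * x
  reorder = solve-∀
  d+kc≤2d : d + k * c ≤ 2 * d
  d+kc≤2d = subst (d + k * c ≤_) (sym (2*m≡m+m d)) (+-monoʳ-≤ d kc≤d)

sum-mono-≤ : {f g : Fin n → ℕ} → (∀ i → f i ≤ g i) → sum f ≤ sum g
sum-mono-≤ {zero}  _   = z≤n
sum-mono-≤ {suc n} f≤g = +-mono-≤ (f≤g zero) (sum-mono-≤ (f≤g ∘ suc))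

sum-const : ∀ n x → ∑[ i < n ] x ≡ n * x
sum-const zero    x = refl
sum-const (suc n) x = cong (x +_) (sum-const n x)

argmax : ∀ .{{_ : NonZero n}} (f : Fin n → ℕ) → ∃ λ j → ∀ i → f i ≤ f j
argmax {suc zero}    f = zero , λ { zero → ≤-refl }
argmax {suc (suc n)} f with argmax (f ∘ suc)
... | j , f∘suc≤fj with ≤-total (f zero) (f (suc j))
...   | inj₁ f0≤fj = suc j , λ { zero → f0≤fj ; (suc i) → f∘suc≤fj i }
...   | inj₂ fj≤f0 = zero  , λ { zero → ≤-refl ; (suc i) → ≤-trans (f∘suc≤fj i) fj≤f0 }

sum≤n*max : ∀ .{{_ : NonZero n}} (f : Fin n → ℕ) → ∃ λ j → sum f ≤ n * f j
sum≤n*max {n} f with argmax f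
... | j , fi≤fj = j , ≤-trans (sum-mono-≤ fi≤fj) (≤-reflexive (sum-const n (f j)))

indicator : Dec A → ℕ
indicator a? = if does a? then 1 else 0

indicator-yes : (a? : Dec A) → A → indicator a? ≡ 1
indicator-yes (yes _) _ = refl
indicator-yes (no ¬a) a = contradiction a ¬a

indicator-× : (a? : Dec A) (b? : Dec B) → indicator (a? ×-dec b?) ≡ indicator a? * indicator b?
indicator-× (yes _) (yes _) = refl
indicator-× (yes _) (no _)  = refl
indicator-× (no _)  _       = refl

count : {P : Pred (Fin n) p} → Decidable P → ℕ
count {n} P? = ∑[ i < n ] indicator (P? i)

count-injection : {P : Pred (Fin d) p} (P? : Decidable P) → n ≤ count P? →
                  Σ (Fin n → Fin d) λ f → Injective _≡_ _≡_ f × (∀ i → P (f i))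
count-injection {n = zero}          P? _ = (λ ()) , (λ { {()} }) , (λ ())
count-injection {zero}  {n = suc n} P? ()
count-injection {suc d} {n = suc n} P? n≤count with P? zero
... | yes P0 =
  let f , f-inj , Pf = count-injection (P? ∘ suc) (s≤s⁻¹ n≤count)
  in  lift 1 f , lift-injective f f-inj 1 , λ { zero → P0 ; (suc i) → Pf i }
... | no _ =
  let f , f-inj , Pf = count-injection (P? ∘ suc) n≤count
  in  suc ∘ f , f-inj ∘ suc-injective , Pf

indicator[b≟true]+indicator[b≟false] : ∀ b → indicator (b ≟ true) + indicator (b ≟ false) ≡ 1
indicator[b≟true]+indicator[b≟false] true  = refl
indicator[b≟true]+indicator[b≟false] false = refl

majority : (f : Fin n → Bool) → Σ Bool λ c → n ≤ 2 * count (λ i → f i ≟ c)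
majority {n} f = choose (≤-total trues falses)
  where
  trues  = count (λ i → f i ≟ true)
  falses = count (λ i → f i ≟ false)

  trues+falses≡n : trues + falses ≡ n
  trues+falses≡n = begin
    trues + falses                                                ≡⟨ ∑-distrib-+ (λ i → indicator (f i ≟ true)) (λ i → indicator (f i ≟ false)) ⟨
    ∑[ i < n ] (indicator (f i ≟ true) + indicator (f i ≟ false)) ≡⟨ sum-cong-≗ (indicator[b≟true]+indicator[b≟false] ∘ f) ⟩
    ∑[ i < n ] 1                                                  ≡⟨ sum-const n 1 ⟩
    n * 1                                                         ≡⟨ *-identityʳ n ⟩
    n                                                             ∎
    where open ≡-Reasoning

  choose : trues ≤ falses ⊎ falses ≤ trues → Σ Bool λ c → n ≤ 2 * count (λ i → f i ≟ c)
  choose (inj₁ t≤f) = false , subst₂ _≤_ trues+falses≡n (sym (2*m≡m+m falses)) (+-monoˡ-≤ falses t≤f)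
  choose (inj₂ f≤t) = true  , subst₂ _≤_ trues+falses≡n (sym (2*m≡m+m trues)) (+-monoʳ-≤ trues f≤t)

degree : Coloring d t → Bool → Fin d → ℕ
degree M c i = count (λ k → M i k ≟ c)

columnDegree : {R : Pred (Fin d) p} → Coloring d t → Bool → Decidable R → Fin t → ℕ
columnDegree M c R? k = count (λ i → R? i ×-dec M i k ≟ c)

removeColumn : Coloring d (suc t) → Fin (suc t) → Coloring d t
removeColumn M j i = removeAt (M i) j

degree-removeColumn : (M : Coloring d (suc t)) (c : Bool) (j : Fin (suc t)) {i : Fin d} →
                      M i j ≡ c → degree M c i ≡ suc (degree (removeColumn M j) c i)
degree-removeColumn M c j {i} Mij≡c = begin
  degree M c i                                                   ≡⟨ sum-remove {i = j} (λ k → indicator (M i k ≟ c)) ⟩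
  indicator (M i j ≟ c) + degree (removeColumn M j) c i          ≡⟨ cong (_+ degree (removeColumn M j) c i) (indicator-yes (M i j ≟ c) Mij≡c) ⟩
  suc (degree (removeColumn M j) c i)                            ∎
  where open ≡-Reasoning

∑-columnDegree : {R : Pred (Fin d) p} (M : Coloring d t) (c : Bool) (R? : Decidable R) →
                 ∑[ k < t ] columnDegree M c R? k ≡ ∑[ i < d ] (indicator (R? i) * degree M c i)
∑-columnDegree {d = d} {t = t} M c R? = begin
  ∑[ k < t ] ∑[ i < d ] indicator (R? i ×-dec M i k ≟ c)         ≡⟨ sum-cong-≗ (λ k → sum-cong-≗ (λ i → indicator-× (R? i) (M i k ≟ c))) ⟩
  ∑[ k < t ] ∑[ i < d ] (indicator (R? i) * indicator (M i k ≟ c)) ≡⟨ ∑-comm (λ k i → indicator (R? i) * indicator (M i k ≟ c)) ⟩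
  ∑[ i < d ] ∑[ k < t ] (indicator (R? i) * indicator (M i k ≟ c)) ≡⟨ sum-cong-≗ (λ i → *-distribˡ-sum (indicator (R? i)) (λ k → indicator (M i k ≟ c))) ⟨
  ∑[ i < d ] (indicator (R? i) * degree M c i)                    ∎
  where open ≡-Reasoning

count*≤∑-columnDegree : {R : Pred (Fin d) p} (M : Coloring d t) (c : Bool) (R? : Decidable R) {a : ℕ} →
                        (∀ {i} → R i → a ≤ degree M c i) → count R? * a ≤ ∑[ k < t ] columnDegree M c R? k
count*≤∑-columnDegree {d = d} M c R? {a} a≤degree = begin
  count R? * a                                  ≡⟨ *-distribʳ-sum a (λ i → indicator (R? i)) ⟩
  ∑[ i < d ] (indicator (R? i) * a)             ≤⟨ sum-mono-≤ pointwise ⟩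
  ∑[ i < d ] (indicator (R? i) * degree M c i)  ≡⟨ ∑-columnDegree M c R? ⟨
  ∑[ k < _ ] columnDegree M c R? k              ∎
  where
  open ≤-Reasoning
  pointwise : ∀ i → indicator (R? i) * a ≤ indicator (R? i) * degree M c i
  pointwise i with R? i
  ... | yes Ri = *-monoʳ-≤ 1 (a≤degree Ri)
  ... | no _   = z≤n

rising : ℕ → ℕ → ℕ
rising q zero    = 1
rising q (suc k) = (q + suc k) * rising q k

record MonochromaticIn {d t : ℕ} (M : Coloring d t) (R : Pred (Fin d) 0ℓ) (c : Bool) (n s : ℕ) : Set where
  field
    rows           : Fin n → Fin d
    cols           : Fin s → Fin t
    rows-injective : Injective _≡_ _≡_ rows
    cols-injective : Injective _≡_ _≡_ cols
    rows∈R         : ∀ i → R (rows i)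
    monochromatic  : ∀ i k → M (rows i) (cols k) ≡ c

injective-∷ : {x : Fin m} {f : Fin n → Fin m} → Injective _≡_ _≡_ f → (∀ i → f i ≢ x) →
              Injective _≡_ _≡_ (x ∷ f)
injective-∷ f-inj f≢x {zero}  {zero}  _     = refl
injective-∷ f-inj f≢x {zero}  {suc j} x≡fj  = contradiction (sym x≡fj) (f≢x j)
injective-∷ f-inj f≢x {suc i} {zero}  fi≡x  = contradiction fi≡x (f≢x i)
injective-∷ f-inj f≢x {suc i} {suc j} fi≡fj = cong suc (f-inj fi≡fj)

greedy-monochromaticIn : ∀ s (M : Coloring d t) (c : Bool) {R : Pred (Fin d) 0ℓ} (R? : Decidable R) (q : ℕ) →
         s ≤ t → (∀ {i} → R i → q + s ≤ degree M c i) →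
         n * t ^ s ≤ count R? * rising q s → MonochromaticIn M R c n s
greedy-monochromaticIn {n = n} zero M c R? q _ _ n≤count
  with count-injection R? (subst₂ _≤_ (*-identityʳ n) (*-identityʳ (count R?)) n≤count)
... | rows , rows-injective , rows∈R = record
  { rows           = rows
  ; cols           = λ ()
  ; rows-injective = rows-injective
  ; cols-injective = λ { {()} }
  ; rows∈R         = rows∈R
  ; monochromatic  = λ _ ()
  }
greedy-monochromaticIn {d = d} {t = suc t} {n = n} (suc s) M c {R} R? q (s≤s s≤t) q+s≤degree bound
  with sum≤n*max (columnDegree M c R?)
... | j , ∑≤ = extend (greedy-monochromaticIn s (removeColumn M j) c R′? q s≤t q+s≤degree′ bound′)
  where
  R′ : Pred (Fin d) 0ℓ
  R′ i = R i × M i j ≡ c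

  R′? : Decidable R′
  R′? i = R? i ×-dec M i j ≟ c

  q+s≤degree′ : ∀ {i} → R′ i → q + s ≤ degree (removeColumn M j) c i
  q+s≤degree′ (Ri , Mij≡c) =
    s≤s⁻¹ (subst₂ _≤_ (+-suc q s) (degree-removeColumn M c j Mij≡c) (q+s≤degree Ri))

  bound′ : n * t ^ s ≤ count R′? * rising q s
  bound′ = *-cancelʳ-≤ _ _ (suc t) (begin
    n * t ^ s * suc t                     ≤⟨ *-monoˡ-≤ (suc t) (*-monoʳ-≤ n (^-monoˡ-≤ s (n≤1+n t))) ⟩
    n * suc t ^ s * suc t                 ≡⟨ *-assoc n (suc t ^ s) (suc t) ⟩
    n * (suc t ^ s * suc t)               ≡⟨ cong (n *_) (*-comm (suc t ^ s) (suc t)) ⟩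
    n * suc t ^ suc s                     ≤⟨ bound ⟩
    count R? * rising q (suc s)           ≡⟨ *-assoc (count R?) (q + suc s) (rising q s) ⟨
    count R? * (q + suc s) * rising q s   ≤⟨ *-monoˡ-≤ (rising q s) (≤-trans (count*≤∑-columnDegree M c R? q+s≤degree) ∑≤) ⟩
    suc t * count R′? * rising q s        ≡⟨ *-assoc (suc t) (count R′?) (rising q s) ⟩
    suc t * (count R′? * rising q s)      ≡⟨ *-comm (suc t) (count R′? * rising q s) ⟩
    count R′? * rising q s * suc t        ∎)
    where open ≤-Reasoning

  extend : MonochromaticIn (removeColumn M j) R′ c n s → MonochromaticIn M R c n (suc s)
  extend sub = record
    { rows           = rows
    ; cols           = j ∷ (punchIn j ∘ cols)
    ; rows-injective = rows-injective
    ; cols-injective = injective-∷ (λ e → cols-injective (punchIn-injective j _ _ e)) (punchInᵢ≢i j ∘ cols)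
    ; rows∈R         = proj₁ ∘ rows∈R
    ; monochromatic  = λ i → λ { zero → proj₂ (rows∈R i) ; (suc k) → monochromatic i k }
    }
    where open MonochromaticIn sub

[1+q]^k≤rising : ∀ q k → suc q ^ k ≤ rising q k
[1+q]^k≤rising q zero    = ≤-refl
[1+q]^k≤rising q (suc k) =
  *-mono-≤ (subst (suc q ≤_) (sym (+-suc q k)) (s≤s (m≤m+n q k))) ([1+q]^k≤rising q k)

[2[q+s]]^s≤2*2^s*rising : ∀ q s → 2 * (s * s) ≤ q + s → (2 * (q + s)) ^ s ≤ 2 * 2 ^ s * rising q s
[2[q+s]]^s≤2*2^s*rising q zero    _         = s≤s z≤n
[2[q+s]]^s≤2*2^s*rising q s@(suc s′) 2s²≤q+s = begin
  (2 * (q + s)) ^ s              ≡⟨ cong (_^ s) (split q s′) ⟩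
  (2 * suc q + 2 * s′) ^ s       ≤⟨ [2d+c]^k≤2*[2d]^k s (suc q) (2 * s′) s[2s′]≤1+q ⟩
  2 * (2 * suc q) ^ s            ≡⟨ cong (2 *_) (^-distribʳ-* 2 (suc q) s) ⟩
  2 * (2 ^ s * suc q ^ s)        ≤⟨ *-monoʳ-≤ 2 (*-monoʳ-≤ (2 ^ s) ([1+q]^k≤rising q s)) ⟩
  2 * (2 ^ s * rising q s)       ≡⟨ *-assoc 2 (2 ^ s) (rising q s) ⟨
  2 * 2 ^ s * rising q s         ∎
  where
  open ≤-Reasoning
  split : ∀ q s′ → 2 * (q + suc s′) ≡ 2 * suc q + 2 * s′
  split = solve-∀
  square : ∀ s′ → 2 * (suc s′ * suc s′) ≡ suc s′ * (2 * s′) + suc s′ + suc s′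
  square = solve-∀
  s[2s′]≤1+q : s * (2 * s′) ≤ suc q
  s[2s′]≤1+q = ≤-trans (m≤m+n _ s) (m≤n⇒m≤1+n (+-cancelʳ-≤ s _ q (subst (_≤ q + s) (square s′) 2s²≤q+s)))

n*t^s≤r*rising : ∀ {t : ℕ} n r q s → 2 * (s * s) ≤ q + s → t ≤ 2 * (q + s) →
                 4 * n * 2 ^ s ≤ 2 * r → n * t ^ s ≤ r * rising q s
n*t^s≤r*rising {t} n r q s 2s²≤q+s t≤2[q+s] 4n2^s≤2r = begin
  n * t ^ s                      ≤⟨ *-monoʳ-≤ n (^-monoˡ-≤ s t≤2[q+s]) ⟩
  n * (2 * (q + s)) ^ s          ≤⟨ *-monoʳ-≤ n ([2[q+s]]^s≤2*2^s*rising q s 2s²≤q+s) ⟩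
  n * (2 * 2 ^ s * rising q s)   ≡⟨ reorder n (2 ^ s) (rising q s) ⟩
  2 * n * 2 ^ s * rising q s     ≤⟨ *-monoˡ-≤ (rising q s) 2n2^s≤r ⟩
  r * rising q s                 ∎
  where
  open ≤-Reasoning
  reorder : ∀ x y z → x * (2 * y * z) ≡ 2 * x * y * z
  reorder = solve-∀
  halve : ∀ x y → 4 * x * y ≡ 2 * (2 * x * y)
  halve = solve-∀
  2n2^s≤r : 2 * n * 2 ^ s ≤ r
  2n2^s≤r = *-cancelˡ-≤ 2 (subst (_≤ 2 * r) (halve n (2 ^ s)) 4n2^s≤2r)

heavyRows : (M : Coloring d t) → Σ Bool λ c → Σ (Pred (Fin d) 0ℓ) λ R → Σ (Decidable R) λ R? →
            d ≤ 2 * count R? × (∀ {i} → R i → t ≤ 2 * degree M c i)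
heavyRows {d = d} M =
  c , (λ i → rowColour i ≡ c) , (λ i → rowColour i ≟ c) , proj₂ (majority rowColour) ,
  λ {i} e → subst (λ c′ → _ ≤ 2 * degree M c′ i) e (proj₂ (majority (M i)))
  where
  rowColour : Fin d → Bool
  rowColour i = proj₁ (majority (M i))
  c : Bool
  c = proj₁ (majority rowColour)

split-⌈t/2⌉ : ∀ s t .{{_ : NonZero s}} → 4 * (s * s) ≤ t → ∃ λ q → q + s ≡ ⌈ t /2⌉ × 2 * (s * s) ≤ q + s
split-⌈t/2⌉ s t 4s²≤t = ⌈ t /2⌉ ∸ s , q+s≡⌈t/2⌉ , subst (2 * (s * s) ≤_) (sym q+s≡⌈t/2⌉) 2s²≤⌈t/2⌉
  where
  2s²≤⌈t/2⌉ : 2 * (s * s) ≤ ⌈ t /2⌉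
  2s²≤⌈t/2⌉ = 2*m≤n⇒m≤⌈n/2⌉ (subst (_≤ t) (*-assoc 2 2 (s * s)) 4s²≤t)
  q+s≡⌈t/2⌉ : ⌈ t /2⌉ ∸ s + s ≡ ⌈ t /2⌉
  q+s≡⌈t/2⌉ = m∸n+n≡m (≤-trans (m≤m*n s s) (≤-trans (m≤n*m (s * s) 2) 2s²≤⌈t/2⌉))

lemma1 : (d t s n : ℕ) → NonZero d → NonZero t → NonZero s → NonZero n →
         4 * (s * s) ≤ t → 4 * n * 2 ^ s ≤ d →
         (M : Coloring d t) → HasMonoSubmatrix M n s
lemma1 d t s n _ _ s≢0 _ 4s²≤t 4n2^s≤d M
  with heavyRows M | split-⌈t/2⌉ s t {{s≢0}} 4s²≤t
... | c , R , R? , d≤2|R| , t≤2degree | q , q+s≡⌈t/2⌉ , 2s²≤q+s =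
  let open MonochromaticIn (greedy-monochromaticIn {n = n} s M c R? q s≤t q+s≤degree bound)
  in  rows , cols , rows-injective , cols-injective , c , monochromatic
  where
  s≤t : s ≤ t
  s≤t = ≤-trans (m≤n+m s q) (subst (_≤ t) (sym q+s≡⌈t/2⌉) (⌈n/2⌉≤n t))

  q+s≤degree : ∀ {i} → R i → q + s ≤ degree M c i
  q+s≤degree {i} Ri = subst (_≤ degree M c i) (sym q+s≡⌈t/2⌉) (n≤2*m⇒⌈n/2⌉≤m (t≤2degree Ri))

  bound : n * t ^ s ≤ count R? * rising q s
  bound = n*t^s≤r*rising n (count R?) q s 2s²≤q+s (subst (λ x → t ≤ 2 * x) (sym q+s≡⌈t/2⌉) (n≤2*⌈n/2⌉ t))
                         (≤-trans 4n2^s≤d d≤2|R|)
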